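{- Let $\phi=F\wedge\forall\bar x.\,Q$ have a satisfiability certificate consisting of a pre-satisfiability certificate $I$, a well-order $\preceq$ on $\mathbb{D}^{k}$, and sets of propagated cells $X_z$ ($z\in\mathbb{D}^k$) with satisfiability propagators. For a cell $u$, let $\mathit{inst}(u)$ be the (unique) $z\in\mathbb{D}^k$ with $u\in X_z$ if such a $z$ exists, and $\bot$ otherwise. Let $u$ be a cell with $\mathit{inst}(u)\neq\bot$. Then for any other cell $v\in\Gamma_{I,\mathit{inst}(u)}(\phi)\setminus\mathit{def}(I)\setminus X_{\mathit{inst}(u)}$ with $\mathit{inst}(v)\neq\bot$, we have $\mathit{inst}(v)\prec\mathit{inst}(u)$.
   Context: Setting. Sorted first-order language; quantified variables $\bar{x}=(x_1,\dots,x_k)$ have sort $\mathbb{D}$; every uninterpreted function symbol takes arguments of sort $\mathbb{D}$ and returns values of sort $\mathbb{D}'$; both sorts have canonical models (denoted the same), $\mathbb{D}$ countable; every $z\in\mathbb{D}$ has a constant $\hat z$ denoting it. $F,Q$ are quantifier-free and arguments of uninterpreted function symbols contain no uninterpreted function symbols of non-zero arity. $args(Q,f)$ is the set of argument tuples of $f$ in $Q$; $s[\bar x\mapsto\bar t]$ is simultaneous substitution. A cell is a term $f(n_1,\dots,n_m)$ with $f$ uninterpreted and $n_i\in\mathbb{D}$. A cell interpretation is a partial map $I$ from cells to $\mathbb{D}'$ with domain $\mathit{def}(I)$; for a term $t$, $I(t)$ is the common value of $t$ under all interpretations agreeing with $I$ on $\mathit{def}(I)$, or $\bot$ if not unique;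 $I\models\psi$ means all such interpretations satisfy $\psi$. A pre-satisfiability certificate of $\phi$ is a finite cell interpretation $I$ with $I\models F$ such that $I(t[\bar x\mapsto\hat z])\neq\bot$ for all $z\in\mathbb{D}^k$, all uninterpreted $f$ and all $t\in args(Q,f)$. Relevant cells: $\Gamma_{I,z}(\phi)=\{f(I(t[\bar x\mapsto\hat z]))\mid t\in args(Q,f), f\text{ uninterpreted}\}$. A satisfiability certificate consists of such an $I$, a well-order $\preceq$ on $\mathbb{D}^k$, and for each $z$ a set $X_z\subseteq\Gamma_{I,z}(\phi)$ with $X_z\cap\mathit{def}(I)=\emptyset$ and $X_z\cap\bigcup_{z'\prec z}\Gamma_{I,z'}(\phi)=\emptyset$, together with a satisfiability propagator witnessing that for all values of the cells in $\Gamma_{I,z}(\phi)\setminus\mathit{def}(I)\setminus X_z$ there exist values for the cells in $X_z$ making $Q[\bar x\mapsto\hat z]$ true together with $I$. -}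

module Defs where

open import Level using (0ℓ)
open import Data.Nat using (ℕ; zero; suc)
open import Data.Fin using (Fin)
open import Data.Vec using (Vec; []; _∷_; lookup)
open import Data.List using (List; []; _∷_; replicate)
open import Data.Maybe using (Maybe; just; nothing)
open import Data.Product using (Σ; Σ-syntax; _×_; _,_; proj₁; proj₂)
open import Data.Unit using (⊤; tt)
open import Data.Empty using (⊥)
open import Relation.Nullary using (¬_)
open import Relation.Binary.PropositionalEquality using (_≡_)
open import Relation.Binary.Core using (Rel)
open import Relation.Binary.Structures using (IsStrictTotalOrder)
open import Induction.WellFounded using (WellFounded)
open import Function.Definitions using (Injective)
open import Data.List.Membership.Propositional using (_∈_)

-- Sorts: 𝔻 (sort of quantified variables / arguments of uninterpreted
-- functions) and 𝔻' (result sort of uninterpreted functions).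

data Sort : Set where
  𝔻 𝔻' : Sort

ValOf : Set → Set → Sort → Set
ValOf D D' 𝔻  = D
ValOf D D' 𝔻' = D'

ValsOf : Set → Set → List Sort → Set
ValsOf D D' []       = ⊤
ValsOf D D' (s ∷ ss) = ValOf D D' s × ValsOf D D' ss

record Theory : Set₁ where
  field
    D D'        : Set
    d₀          : D
    d₀'         : D'
    D-countable : Σ (D → ℕ) (λ e → Injective _≡_ _≡_ e)
    IFun        : Set
    ifDom       : IFun → List Sort
    ifCod       : IFun → Sort
    ifSem       : (g : IFun) → ValsOf D D' (ifDom g) → ValOf D D' (ifCod g)
    IPred       : Set
    ipDom       : IPred → List Sort
    ipSem       : (p : IPred) → ValsOf D D' (ipDom p) → Set
    UF          : Set
    arity       : UF → ℕ

module Lang (T : Theory) where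
  open Theory T public

  Val : Sort → Set
  Val = ValOf D D'

  Vals : List Sort → Set
  Vals = ValsOf D D'

  -- Terms and quantifier-free formulas over k quantified variables
  -- x₁ … x_k (of sort 𝔻).  'lit z' is the constant ẑ denoting z ∈ D.

  mutual
    data Term (k : ℕ) : Sort → Set where
      var : Fin k → Term k 𝔻
      lit : D → Term k 𝔻
      uf  : (f : UF) → Terms k (replicate (arity f) 𝔻) → Term k 𝔻'
      ifn : (g : IFun) → Terms k (ifDom g) → Term k (ifCod g)

    data Terms (k : ℕ) : List Sort → Set where
      []  : Terms k []
      _∷_ : ∀ {s ss} → Term k s → Terms k ss → Terms k (s ∷ ss)

  data Formula (k : ℕ) : Set where
    ⊤ᶠ   : Formula k
    atom : (p : IPred) → Terms k (ipDom p) → Formula k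
    eqᶠ  : ∀ {s} → Term k s → Term k s → Formula k
    ¬ᶠ   : Formula k → Formula k
    _∧ᶠ_ : Formula k → Formula k → Formula k
    _∨ᶠ_ : Formula k → Formula k → Formula k

  ArgTuple : ℕ → UF → Set
  ArgTuple k f = Terms k (replicate (arity f) 𝔻)

  mutual
    substT : ∀ {k s} → Vec D k → Term k s → Term 0 s
    substT z (var i)    = lit (lookup z i)
    substT z (lit d)    = lit d
    substT z (uf f ts)  = uf f (substTs z ts)
    substT z (ifn g ts) = ifn g (substTs z ts)

    substTs : ∀ {k ss} → Vec D k → Terms k ss → Terms 0 ss
    substTs z []       = []
    substTs z (t ∷ ts) = substT z t ∷ substTs z ts

  substF : ∀ {k} → Vec D k → Formula k → Formula 0
  substF z ⊤ᶠ          = ⊤ᶠ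
  substF z (atom p ts) = atom p (substTs z ts)
  substF z (eqᶠ a b)   = eqᶠ (substT z a) (substT z b)
  substF z (¬ᶠ φ)      = ¬ᶠ (substF z φ)
  substF z (φ ∧ᶠ ψ)    = substF z φ ∧ᶠ substF z ψ
  substF z (φ ∨ᶠ ψ)    = substF z φ ∨ᶠ substF z ψ

  -- Occurrences: ArgOfF φ f ts  iff  f(ts) occurs in φ,
  -- i.e. ts ∈ args(φ, f).

  mutual
    data ArgOfT {k : ℕ} : ∀ {s} → Term k s → (f : UF) → ArgTuple k f → Set where
      here  : ∀ {f ts} → ArgOfT (uf f ts) f ts
      inUF  : ∀ {g ts f us} → ArgOfTs ts f us → ArgOfT (uf g ts) f us
      inIF  : ∀ {g ts f us} → ArgOfTs ts f us → ArgOfT (ifn g ts) f us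

    data ArgOfTs {k : ℕ} : ∀ {ss} → Terms k ss → (f : UF) → ArgTuple k f → Set where
      hd : ∀ {s ss} {t : Term k s} {ts : Terms k ss} {f us} → ArgOfT t f us → ArgOfTs (t ∷ ts) f us
      tl : ∀ {s ss} {t : Term k s} {ts : Terms k ss} {f us} → ArgOfTs ts f us → ArgOfTs (t ∷ ts) f us

  data ArgOfF {k : ℕ} : Formula k → (f : UF) → ArgTuple k f → Set where
    inAtom : ∀ {p ts f us} → ArgOfTs ts f us → ArgOfF (atom p ts) f us
    inEqˡ  : ∀ {s} {a b : Term k s} {f us} → ArgOfT a f us → ArgOfF (eqᶠ a b) f us
    inEqʳ  : ∀ {s} {a b : Term k s} {f us} → ArgOfT b f us → ArgOfF (eqᶠ a b) f us
    inNeg  : ∀ {φ f us} → ArgOfF φ f us → ArgOfF (¬ᶠ φ) f us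
    inAndˡ : ∀ {φ ψ f us} → ArgOfF φ f us → ArgOfF (φ ∧ᶠ ψ) f us
    inAndʳ : ∀ {φ ψ f us} → ArgOfF ψ f us → ArgOfF (φ ∧ᶠ ψ) f us
    inOrˡ  : ∀ {φ ψ f us} → ArgOfF φ f us → ArgOfF (φ ∨ᶠ ψ) f us
    inOrʳ  : ∀ {φ ψ f us} → ArgOfF ψ f us → ArgOfF (φ ∨ᶠ ψ) f us

  mutual
    data FlatT {k : ℕ} : ∀ {s} → Term k s → Set where
      fvar : ∀ {i} → FlatT (var i)
      flit : ∀ {d} → FlatT (lit d)
      fuf0 : ∀ {g ts} → arity g ≡ 0 → FlatT (uf g ts)
      fifn : ∀ {g ts} → FlatTs ts → FlatT (ifn g ts)

    data FlatTs {k : ℕ} : ∀ {ss} → Terms k ss → Set where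
      []  : FlatTs []
      _∷_ : ∀ {s ss} {t : Term k s} {ts : Terms k ss} → FlatT t → FlatTs ts → FlatTs (t ∷ ts)

  FlatArgs : ∀ {k} → Formula k → Set
  FlatArgs φ = ∀ f ts → ArgOfF φ f ts → FlatTs ts

  Cell : Set
  Cell = Σ UF (λ f → Vec D (arity f))

  Interp : Set
  Interp = Cell → D'

  toVec : ∀ n → Vals (replicate n 𝔻) → Vec D n
  toVec zero    _        = []
  toVec (suc n) (d , ds) = d ∷ toVec n ds

  mutual
    evalT : ∀ {s} → Interp → Term 0 s → Val s
    evalT J (lit d)    = d
    evalT J (uf f ts)  = J (f , toVec (arity f) (evalTs J ts))
    evalT J (ifn g ts) = ifSem g (evalTs J ts)

    evalTs : ∀ {ss} → Interp → Terms 0 ss → Vals ss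
    evalTs J []       = tt
    evalTs J (t ∷ ts) = evalT J t , evalTs J ts

  evalArgs : ∀ {f} → Interp → ArgTuple 0 f → Vec D (arity f)
  evalArgs {f} J ts = toVec (arity f) (evalTs J ts)

  ⟦_⟧ᶠ : Formula 0 → Interp → Set
  ⟦ ⊤ᶠ ⟧ᶠ J        = ⊤
  ⟦ atom p ts ⟧ᶠ J = ipSem p (evalTs J ts)
  ⟦ eqᶠ a b ⟧ᶠ J   = evalT J a ≡ evalT J b
  ⟦ ¬ᶠ φ ⟧ᶠ J      = ¬ (⟦ φ ⟧ᶠ J)
  ⟦ φ ∧ᶠ ψ ⟧ᶠ J    = ⟦ φ ⟧ᶠ J × ⟦ ψ ⟧ᶠ J
  ⟦ φ ∨ᶠ ψ ⟧ᶠ J    = ⟦ φ ⟧ᶠ J Data.Sum.⊎ ⟦ ψ ⟧ᶠ J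
    where import Data.Sum

  CellInterp : Set
  CellInterp = Cell → Maybe D'

  Def : CellInterp → Cell → Set
  Def I c = Σ D' (λ d → I c ≡ just d)

  FiniteCI : CellInterp → Set
  FiniteCI I = Σ (List Cell) (λ cs → ∀ c → Def I c → c ∈ cs)

  Extends : Interp → CellInterp → Set
  Extends J I = ∀ c d → I c ≡ just d → J c ≡ d

  DetT : ∀ {s} → CellInterp → Term 0 s → Val s → Set
  DetT I t v = ∀ J → Extends J I → evalT J t ≡ v

  DetArgs : ∀ {f} → CellInterp → ArgTuple 0 f → Vec D (arity f) → Set
  DetArgs I ts ns = ∀ J → Extends J I → evalArgs J ts ≡ ns

  _⊨_ : CellInterp → Formula 0 → Set
  I ⊨ ψ = ∀ J → Extends J I → ⟦ ψ ⟧ᶠ J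

  -- φ = F ∧ ∀x̄. Q  with F ground and Q over k variables.

  module _ {k : ℕ} (F : Formula 0) (Q : Formula k) where

    record PreSatCert (I : CellInterp) : Set where
      field
        finite : FiniteCI I
        satF   : I ⊨ F
        determ : ∀ (z : Vec D k) f (ts : ArgTuple k f) → ArgOfF Q f ts →
                 Σ (Vec D (arity f)) (λ ns → DetArgs I (substTs z ts) ns)

    Γ : CellInterp → Vec D k → Cell → Set
    Γ I z (f , ns) = Σ (ArgTuple k f) (λ ts → ArgOfF Q f ts × DetArgs I (substTs z ts) ns)

    -- Satisfiability propagator for z: for all values of the cells
    -- outside X_z (in particular of Γ_{I,z} ∖ def(I) ∖ X_z), agreeing with I,
    -- there are values for the cells in X_z making Q[x̄ ↦ ẑ] true together with I.
    Propagator : CellInterp → (Cell → Set) → Vec D k → Set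
    Propagator I Xz z =
      ∀ J → Extends J I →
      Σ Interp (λ J' → Extends J' I × (∀ c → ¬ Xz c → J' c ≡ J c) × ⟦ substF z Q ⟧ᶠ J')

    record SatCert : Set₁ where
      field
        I       : CellInterp
        pre     : PreSatCert I
        _≺_     : Rel (Vec D k) 0ℓ
        ≺-sto   : IsStrictTotalOrder _≡_ _≺_
        ≺-wf    : WellFounded _≺_
        X       : Vec D k → Cell → Set
        X⊆Γ     : ∀ z c → X z c → Γ I z c
        X∩def   : ∀ z c → X z c → ¬ Def I c
        X∩prev  : ∀ z z' c → z' ≺ z → X z c → ¬ Γ I z' c
        prop    : ∀ z → Propagator I (X z) z

module Submission where

open import Defs
open import Data.Nat using (ℕ)
open import Data.Vec using (Vec)
open import Relation.Nullary using (¬_; contradiction)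
open import Relation.Binary.Core using (Rel)
open import Relation.Binary.Definitions using (tri<; tri≈; tri>)
open import Relation.Binary.Structures using (IsStrictTotalOrder)
open import Relation.Binary.PropositionalEquality using (_≡_; _≢_; refl)

≢∧≯⇒< : ∀ {a ℓ} {A : Set a} {_<_ : Rel A ℓ} → IsStrictTotalOrder _≡_ _<_ →
        ∀ {x y} → x ≢ y → ¬ (y < x) → x < y
≢∧≯⇒< sto {x} {y} x≢y y≮x with IsStrictTotalOrder.compare sto x y
... | tri< x<y _ _ = x<y
... | tri≈ _ x≡y _ = contradiction x≡y x≢y
... | tri> _ _ y<x = contradiction y<x y≮x

mainTheorem2 : (T : Theory) (k : ℕ) →
    let open Lang T in
    (F : Formula 0) (Q : Formula k) →
    FlatArgs F → FlatArgs Q →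
    (C : SatCert F Q) →
    let open SatCert C in
    ∀ (u v : Cell) (zu zv : Vec D k) →
    X zu u → X zv v →
    Γ F Q I zu v → ¬ Def I v → ¬ X zu v →
    zv ≺ zu
mainTheorem2 T k F Q _ _ C u v zu zv _ v∈Xzv v∈Γzu _ v∉Xzu =
  ≢∧≯⇒< ≺-sto zv≢zu zu⊀zv
  where
  open Lang.SatCert C

  zv≢zu : zv ≢ zu
  zv≢zu refl = v∉Xzu v∈Xzv

  zu⊀zv : ¬ (zu ≺ zv)
  zu⊀zv zu≺zv = X∩prev zv zu v zu≺zv v∈Xzv v∈Γzu
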